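{- Let $G=(N,A)$ be an undirected graph with $N=\{u_1,\dots,u_n\}$ and $|A|=m$, and let $k$ be a positive integer. Construct an offloading instance as follows: for each $u_i\in N$ create a task $v_i$ with $w_i^{edg}=w_i^{cld}=0$; for each edge $\{u_i,u_j\}\in A$ create a directed edge $e(v_i,v_j)$ (one per edge of $A$) with communication costs $l_{ij}^1=l_{ij}^4=m$ and $l_{ij}^2=l_{ij}^3=1$. If $G$ has a cut $(N_1,N_2)$ (a partition of $N$) with at least $k$ edges of $A$ between $N_1$ and $N_2$, then this offloading instance has a partition $V=V_{edg}\cup V_{cld}$ of total cost at most $C=m(m-k)+k$.
   Context: Offloading problem: tasks $V=\{v_1,\dots,v_n\}$ are partitioned into disjoint sets $V_{edg}$ (executed on the edge server) and $V_{cld}$ (executed on the cloud server), $V_{edg}\cup V_{cld}=V$. Each task $v_i$ has computation cost $w_i^{edg}$ on the edge and $w_i^{cld}$ on the cloud. Each directed edge $e(v_i,v_j)$ has communication cost $l_{ij}^1$ if both endpoints are on the edge, $l_{ij}^2$ if $v_i$ is on the edge and $v_j$ on the cloud, $l_{ij}^3$ if $v_i$ is on the cloud and $v_j$ on the edge, and $l_{ij}^4$ if both are on the cloud. The total cost of a partition is the sum of the computation costs of all tasks on their assigned sides plus the sum over all directed edges of the communication cost corresponding to the sides of their endpoints. -}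

module Defs where

open import Data.Nat using (ℕ; zero; suc; _+_; _*_; _∸_; _≤_)
open import Data.Fin using (Fin)
open import Data.Bool using (Bool; true; false; if_then_else_)
open import Data.List using (List; []; _∷_; length; map; filterᵇ)
open import Data.Nat.ListAction using (sum)
open import Data.List.Relation.Unary.All using (All)
open import Data.List.Relation.Unary.AllPairs using (AllPairs)
open import Data.Product using (_×_; _,_; proj₁; proj₂)
open import Data.Sum using (_⊎_)
open import Data.Fin using (_≟_)
open import Relation.Nullary using (¬_; does)
open import Relation.Binary.PropositionalEquality using (_≡_; _≢_)
open import Data.Vec.Functional using (Vector; foldr)

data Side : Set where
  edg cld : Side

record DEdge (n : ℕ) : Set where
  constructor dedge
  field
    src tgt : Fin n
    l1 l2 l3 l4 : ℕ

record Instance : Set where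
  constructor instance′
  field
    n     : ℕ
    wEdg  : Fin n → ℕ
    wCld  : Fin n → ℕ
    edges : List (DEdge n)

-- a partition V = V_edg ∪ V_cld (disjoint) is an assignment of each task to a side
Partition : ℕ → Set
Partition n = Fin n → Side

compCost : (I : Instance) → Partition (Instance.n I) → Fin (Instance.n I) → ℕ
compCost I p i with p i
... | edg = Instance.wEdg I i
... | cld = Instance.wCld I i

commCost : ∀ {n} → Partition n → DEdge n → ℕ
commCost p e with p (DEdge.src e) | p (DEdge.tgt e)
... | edg | edg = DEdge.l1 e
... | edg | cld = DEdge.l2 e
... | cld | edg = DEdge.l3 e
... | cld | cld = DEdge.l4 e

sumFin : ∀ {n} → (Fin n → ℕ) → ℕ
sumFin f = foldr _+_ 0 f

totalCost : (I : Instance) → Partition (Instance.n I) → ℕ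
totalCost I p = sumFin (compCost I p) + sum (map (commCost p) (Instance.edges I))

SameEdge : ∀ {n} → Fin n × Fin n → Fin n × Fin n → Set
SameEdge (a , b) (c , d) = (a ≡ c × b ≡ d) ⊎ (a ≡ d × b ≡ c)

record Graph (n : ℕ) : Set where
  constructor graph
  field
    edges  : List (Fin n × Fin n)
    noLoop : All (λ e → proj₁ e ≢ proj₂ e) edges
    noDup  : AllPairs (λ e f → ¬ SameEdge e f) edges

numEdges : ∀ {n} → Graph n → ℕ
numEdges G = length (Graph.edges G)

-- a cut (N₁, N₂) of N: vertices mapped to true form N₁, to false form N₂
Cut : ℕ → Set
Cut n = Fin n → Bool

crosses : ∀ {n} → Cut n → Fin n × Fin n → Bool
crosses c (a , b) with c a | c b
... | true  | false = true
... | false | true  = true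
... | _     | _     = false

cutSize : ∀ {n} → Graph n → Cut n → ℕ
cutSize G c = length (filterᵇ (crosses c) (Graph.edges G))

reduction : ∀ {n} → Graph n → Instance
reduction {n} G = instance′ n (λ _ → 0) (λ _ → 0)
  (map (λ e → dedge (proj₁ e) (proj₂ e) m 1 1 m) (Graph.edges G))
  where m = numEdges G

-- Put N₁ on the edge and N₂ on the cloud. Computation is free, a crossing
-- edge costs 1 and any other edge costs m, so a cut of size x yields cost
-- x + m (m − x). As k ≥ 1 forces m ≥ 1, this decreases in x, hence is at most
-- k + m (m − k) once x ≥ k.
module Submission where

open import Defs
open import Data.Nat using (ℕ; zero; suc; _+_; _*_; _∸_; _≤_)
open import Data.Nat.Properties
  using ( +-suc; +-assoc; *-zeroʳ; *-identityˡ; m+n∸m≡n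
        ; ≤-reflexive; ≤-trans; m≤m+n; m≤n⇒∃[o]m+o≡n
        ; +-monoˡ-≤; +-monoʳ-≤; *-monoˡ-≤; module ≤-Reasoning )
open import Data.Nat.ListAction using (sum)
open import Data.Nat.Tactic.RingSolver using (solve-∀)
open import Data.Bool using (Bool; true; false; not; if_then_else_)
open import Data.List using (List; []; _∷_; length; map; filterᵇ)
open import Data.List.Properties using (map-∘; map-cong)
open import Data.Fin using (Fin)
open import Data.Product using (Σ; _,_; proj₁; proj₂; _×_)
open import Function using (_∘_)
open import Relation.Binary.PropositionalEquality
  using (_≡_; refl; cong; cong₂; sym; trans; module ≡-Reasoning)

sumFin-zero : ∀ {n} (f : Fin n → ℕ) → (∀ i → f i ≡ 0) → sumFin f ≡ 0
sumFin-zero {zero}  f f≡0 = refl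
sumFin-zero {suc n} f f≡0 =
  cong₂ _+_ (f≡0 Fin.zero) (sumFin-zero (f ∘ Fin.suc) (f≡0 ∘ Fin.suc))

length-filterᵇ-complement : ∀ {A : Set} (p : A → Bool) (xs : List A) →
  length (filterᵇ p xs) + length (filterᵇ (not ∘ p) xs) ≡ length xs
length-filterᵇ-complement p [] = refl
length-filterᵇ-complement p (x ∷ xs) with p x | length-filterᵇ-complement p xs
... | true  | ih = cong suc ih
... | false | ih = trans (+-suc _ _) (cong suc ih)

sum-map-if : ∀ {A : Set} (p : A → Bool) (a b : ℕ) (xs : List A) →
  sum (map (λ x → if p x then a else b) xs)
    ≡ a * length (filterᵇ p xs) + b * length (filterᵇ (not ∘ p) xs)
sum-map-if p a b [] = sym (cong₂ _+_ (*-zeroʳ a) (*-zeroʳ b))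
sum-map-if p a b (x ∷ xs) with p x | sum-map-if p a b xs
... | true  | ih = trans (cong (a +_) ih) (count-first a b _ _)
  where
  count-first : ∀ a b F G → a + (a * F + b * G) ≡ a * suc F + b * G
  count-first = solve-∀
... | false | ih = trans (cong (b +_) ih) (count-second a b _ _)
  where
  count-second : ∀ a b F G → b + (a * F + b * G) ≡ a * F + b * suc G
  count-second = solve-∀

cutPartition : ∀ {n} → Cut n → Partition n
cutPartition c i = if c i then edg else cld

compCost-reduction : ∀ {n} (G : Graph n) (p : Partition n) (i : Fin n) →
  compCost (reduction G) p i ≡ 0
compCost-reduction G p i with p i
... | edg = refl
... | cld = refl

commCost-cutPartition : ∀ {n} (c : Cut n) (m : ℕ) (e : Fin n × Fin n) →
  commCost (cutPartition c) (dedge (proj₁ e) (proj₂ e) m 1 1 m)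
    ≡ (if crosses c e then 1 else m)
commCost-cutPartition c m (a , b) with c a | c b
... | true  | true  = refl
... | true  | false = refl
... | false | true  = refl
... | false | false = refl

totalCost-cutPartition : ∀ {n} (G : Graph n) (c : Cut n) →
  totalCost (reduction G) (cutPartition c)
    ≡ cutSize G c + numEdges G * length (filterᵇ (not ∘ crosses c) (Graph.edges G))
totalCost-cutPartition G c = begin
  sumFin (compCost (reduction G) (cutPartition c)) + sum (map (commCost (cutPartition c)) (map toDEdge A))
    ≡⟨ cong₂ _+_ (sumFin-zero _ (compCost-reduction G (cutPartition c))) (cong sum (sym (map-∘ A))) ⟩
  sum (map (commCost (cutPartition c) ∘ toDEdge) A)
    ≡⟨ cong sum (map-cong (commCost-cutPartition c m) A) ⟩
  sum (map (λ e → if crosses c e then 1 else m) A)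
    ≡⟨ sum-map-if (crosses c) 1 m A ⟩
  1 * cutSize G c + m * length (filterᵇ (not ∘ crosses c) A)
    ≡⟨ cong (_+ m * length (filterᵇ (not ∘ crosses c) A)) (*-identityˡ (cutSize G c)) ⟩
  cutSize G c + m * length (filterᵇ (not ∘ crosses c) A) ∎
  where
  open ≡-Reasoning
  A = Graph.edges G
  m = numEdges G
  toDEdge : Fin _ × Fin _ → DEdge _
  toDEdge e = dedge (proj₁ e) (proj₂ e) m 1 1 m

cost-antitone : ∀ {k x y m} → 1 ≤ k → k ≤ x → x + y ≡ m →
  x + m * y ≤ m * (m ∸ k) + k
cost-antitone {k = k} {y = y} 1≤k k≤x refl with m≤n⇒∃[o]m+o≡n k≤x
... | d , refl = begin
  k + d + m * y         ≤⟨ +-monoˡ-≤ (m * y) (+-monoʳ-≤ k d≤m*d) ⟩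
  k + m * d + m * y     ≡⟨ regroup m d k y ⟩
  m * (d + y) + k       ≡⟨ cong (λ z → m * z + k) (sym m∸k≡d+y) ⟩
  m * (m ∸ k) + k       ∎
  where
  open ≤-Reasoning
  m = k + d + y
  regroup : ∀ m d k y → k + m * d + m * y ≡ m * (d + y) + k
  regroup = solve-∀
  m∸k≡d+y : m ∸ k ≡ d + y
  m∸k≡d+y = trans (cong (_∸ k) (+-assoc k d y)) (m+n∸m≡n k (d + y))
  d≤m*d : d ≤ m * d
  d≤m*d = ≤-trans (≤-reflexive (sym (*-identityˡ d)))
                  (*-monoˡ-≤ d (≤-trans 1≤k (≤-trans (m≤m+n k d) (m≤m+n (k + d) y))))

lemma3 : ∀ {n} (G : Graph n) (k : ℕ) → 1 ≤ k →
    (Σ (Cut n) λ c → k ≤ cutSize G c) →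
    Σ (Partition n) λ p →
      totalCost (reduction G) p ≤ numEdges G * (numEdges G ∸ k) + k
lemma3 G k 1≤k (c , k≤cutSize) = cutPartition c , (begin
  totalCost (reduction G) (cutPartition c)  ≡⟨ totalCost-cutPartition G c ⟩
  cutSize G c + numEdges G * length (filterᵇ (not ∘ crosses c) (Graph.edges G))
    ≤⟨ cost-antitone 1≤k k≤cutSize (length-filterᵇ-complement (crosses c) (Graph.edges G)) ⟩
  numEdges G * (numEdges G ∸ k) + k         ∎)
  where open ≤-Reasoning
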